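{- For every finite simple graph $G$ with maximum degree at most $3$ (a subcubic graph), $\overrightarrow{\beta}(G,1)\le 2$.
   Context: Firefighting on oriented graphs: an orientation $\overrightarrow{G}$ of a finite simple graph $G$ replaces each edge $uv$ by exactly one of the arcs $\overrightarrow{uv}$, $\overrightarrow{vu}$. Let $f\ge 1$ be an integer. A fire breaks out at a vertex $v$ at time $1$ ($v$ burns). At the end of each time unit, the firefighters permanently protect up to $f$ vertices that are neither burning nor already protected. At the next time unit, every vertex that is neither burning nor protected and is an out-neighbour of a burning vertex starts to burn. The process ends when no new vertex can burn. $\beta(\overrightarrow{G},f)$ is the maximum, over all starting vertices $v$, of the minimum, over all protection strategies, of the number of vertices that burn. $\overrightarrow{\beta}(G,f)$ is the minimum of $\beta(\overrightarrow{G},f)$ over all orientations $\overrightarrow{G}$ of $G$. -}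

module Defs where

open import Data.Nat using (ℕ; zero; suc; _≤_)
open import Data.Bool using (Bool; true; false; _∧_; _∨_; not)
open import Data.Fin using (Fin; zero; suc)
open import Data.Fin.Subset using (Subset; _∈_; _∉_; _∪_; _∩_; ∁; ⊥; ⁅_⁆; ∣_∣)
open import Data.Vec using (tabulate)
open import Data.Product using (_×_; Σ; ∃)
open import Data.Sum using (_⊎_)
open import Relation.Binary.PropositionalEquality using (_≡_)

record Graph (n : ℕ) : Set where
  field
    adj   : Fin n → Fin n → Bool
    sym   : ∀ u v → adj u v ≡ adj v u
    irrefl : ∀ v → adj v v ≡ false
open Graph public

N : ∀ {n} → Graph n → Fin n → Subset n
N G v = tabulate (adj G v)

deg : ∀ {n} → Graph n → Fin n → ℕ
deg G v = ∣ N G v ∣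

Subcubic : ∀ {n} → Graph n → Set
Subcubic G = ∀ v → deg G v ≤ 3

record Orientation {n : ℕ} (G : Graph n) : Set where
  field
    arc      : Fin n → Fin n → Bool
    arc⇒adj  : ∀ u v → arc u v ≡ true → adj G u v ≡ true
    exactly1 : ∀ u v → adj G u v ≡ true →
               (arc u v ≡ true × arc v u ≡ false) ⊎ (arc u v ≡ false × arc v u ≡ true)
open Orientation public

anyFin : ∀ {n} → (Fin n → Bool) → Bool
anyFin {zero}  p = false
anyFin {suc n} p = p zero ∨ anyFin (λ i → p (suc i))

outN : ∀ {n} {G : Graph n} → Orientation G → Subset n → Subset n
outN {n} D B = tabulate λ w → anyFin λ u → Data.Vec.lookup B u ∧ arc D u w

spread : ∀ {n} {G : Graph n} → Orientation G → Subset n → Subset n → Subset n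
spread D B Q = B ∪ (outN D B ∩ ∁ Q)

Contained : ∀ {n} {G : Graph n} → Orientation G → Subset n → Subset n → Set
Contained {n} D B P = ∀ (u w : Fin n) → u ∈ B → arc D u w ≡ true → (w ∈ B ⊎ w ∈ P)

-- From the state (burning B, protected P), the firefighters (f per time unit)
-- have a protection strategy such that the process ends with at most k
-- burnt vertices.
data CanContain {n} {G : Graph n} (D : Orientation G) (f k : ℕ)
     : Subset n → Subset n → Set where
  done : ∀ {B P} → Contained D B P → ∣ B ∣ ≤ k → CanContain D f k B P
  step : ∀ {B P} (S : Subset n) →
         ∣ S ∣ ≤ f → S ∩ B ≡ ⊥ → S ∩ P ≡ ⊥ →
         CanContain D f k (spread D B (P ∪ S)) (P ∪ S) →
         CanContain D f k B P

βOriented≤ : ∀ {n} {G : Graph n} → Orientation G → ℕ → ℕ → Set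
βOriented≤ {n} D f k = ∀ (v : Fin n) → CanContain D f k ⁅ v ⁆ ⊥

β⃗≤ : ∀ {n} → Graph n → ℕ → ℕ → Set
β⃗≤ G f k = Σ (Orientation G) λ D → βOriented≤ D f k

module Submission where

-- Order the vertices greedily: after placing x, place next an
-- unplaced neighbour of x if there is one.  With rank = position in this
-- order, every edge xy with rank x < rank y has the successor of x (the
-- vertex of rank x + 1) adjacent to x.  Orient an edge between consecutive
-- vertices backwards and every other edge forwards.  Then a forward arc v → d
-- makes the successor of v an in-neighbour of v, so in a subcubic graph
--   * a vertex with two out-neighbours has exactly two, one of them reached
--     by a forward arc v → d, and
--   * such a d has in-neighbours v and its own successor, so at most one
--     out-neighbour.  If the fire starts at v with at most one out-neighbour, protect
-- it.  Otherwise protecting the out-neighbour of v other than d, then the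
-- single out-neighbour of d, stops the fire at {v, d}.

open import Defs
open import Data.Nat using (ℕ; zero; suc; _≤_; _<_; z≤n; s≤s; _+_)
open import Data.Nat.Properties
  using (≤-reflexive; ≤-trans; ≤-pred; <-asym; <-irrefl; <-trans; suc-injective; n≮0;
         +-suc; +-monoʳ-≤; n≤1+n; <-cmp; _≟_; _<?_; module ≤-Reasoning)
open import Data.Bool using (Bool; true; false; _∧_)
import Data.Bool as Bool
open import Data.Bool.Properties using (∧-conicalˡ; ∧-conicalʳ; ∧-zeroʳ)
open import Relation.Binary.Definitions using (tri<; tri≈; tri>)
open import Data.Fin using (Fin) renaming (_≟_ to _≟ᶠ_)
import Data.Fin.Properties as Fin
open import Data.Fin.Subset using (Subset; _∈_; _∉_; _∪_; _∩_; ⊥; ⁅_⁆; ∣_∣; _⊆_; _-_)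
open import Data.Fin.Subset.Properties
  using (_∈?_; x∈p∪q⁺; x∈p∪q⁻; x∈p∩q⁺; x∈p∩q⁻; x∈∁p⇒x∉p; x∉p⇒x∈∁p; x∈⁅x⁆; x∈⁅y⁆⇒x≡y;
         ∣⁅x⁆∣≡1; ∉⊥; Empty-unique; p⊆q⇒∣p∣≤∣q∣; x∈p∧x≢y⇒x∈p-y; x∈p⇒∣p-x∣<∣p∣)
open import Data.Vec using ([]; _∷_; lookup; tabulate)
open import Data.Vec.Properties using (lookup∘tabulate; []=⇒lookup; lookup⇒[]=)
open import Data.Product using (_×_; ∃; ∃₂; _,_) renaming (map to ×-map)
open import Data.Sum using (_⊎_; inj₁; inj₂; swap) renaming (map to ⊎-map)
open import Data.Empty using (⊥-elim)
open import Data.Unit using (⊤; tt)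
open import Function using (_∘_; id; case_of_)
open import Relation.Nullary using (Dec; yes; no; ¬_; does)
open import Relation.Nullary.Decidable using (_×-dec_; _⊎-dec_; ¬?; dec-true; dec-false)
open import Relation.Binary.PropositionalEquality
  using (_≡_; _≢_; refl; trans; cong; cong₂; subst; ≢-sym; setoid) renaming (sym to ≡-sym)

open import Data.List using (List; length; _++_; allFin) renaming ([] to []ₗ; _∷_ to _∷ₗ_)
open import Data.List.Relation.Unary.All using (All) renaming ([] to []ᵃ; _∷_ to _∷ᵃ_)
import Data.List.Relation.Unary.All as All
open import Data.List.Relation.Unary.AllPairs using () renaming ([] to []ᵖ; _∷_ to _∷ᵖ_)
open import Data.List.Relation.Unary.Unique.Propositional using (Unique)
import Data.List.Relation.Unary.Any as Any
open import Data.List.Membership.Propositional using (find; lose) renaming (_∈_ to _∈ₗ_)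
open import Data.List.Membership.Propositional.Properties using (∈-∃++; ∈-allFin)
open import Data.List.Relation.Binary.Permutation.Propositional
  using (_↭_; ↭-refl; ↭-prep; ↭-sym; ↭-trans; ↭⇒↭ₛ)
open import Data.List.Relation.Binary.Permutation.Propositional.Properties
  using (shift; ↭-length; ∈-resp-↭)
import Data.List.Relation.Binary.Permutation.Setoid.Properties as PermutationSetoid
open import Data.List.Relation.Unary.Unique.Propositional.Properties using (allFin⁺)
open import Data.List.Properties using (length-tabulate)

∈-tabulate⁺ : ∀ {n} (f : Fin n → Bool) {x} → f x ≡ true → x ∈ tabulate f
∈-tabulate⁺ f {x} fx = lookup⇒[]= x (tabulate f) (trans (lookup∘tabulate f x) fx)

∈-tabulate⁻ : ∀ {n} (f : Fin n → Bool) {x} → x ∈ tabulate f → f x ≡ true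
∈-tabulate⁻ f {x} x∈ = trans (≡-sym (lookup∘tabulate f x)) ([]=⇒lookup x∈)

⁅⁆-disjoint : ∀ {n} {a : Fin n} {X : Subset n} → a ∉ X → ⁅ a ⁆ ∩ X ≡ ⊥
⁅⁆-disjoint {a = a} a∉X = Empty-unique λ (x , x∈) → case x∈p∩q⁻ _ _ x∈ of λ
  (x∈⁅a⁆ , x∈X) → a∉X (subst (_∈ _) (x∈⁅y⁆⇒x≡y a x∈⁅a⁆) x∈X)

∣p∪q∣≤∣p∣+∣q∣ : ∀ {n} (p q : Subset n) → ∣ p ∪ q ∣ ≤ ∣ p ∣ + ∣ q ∣
∣p∪q∣≤∣p∣+∣q∣ []          []          = z≤n
∣p∪q∣≤∣p∣+∣q∣ (true ∷ p)  (true ∷ q)  =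
  s≤s (≤-trans (∣p∪q∣≤∣p∣+∣q∣ p q) (+-monoʳ-≤ ∣ p ∣ (n≤1+n _)))
∣p∪q∣≤∣p∣+∣q∣ (true ∷ p)  (false ∷ q) = s≤s (∣p∪q∣≤∣p∣+∣q∣ p q)
∣p∪q∣≤∣p∣+∣q∣ (false ∷ p) (true ∷ q)  =
  ≤-trans (s≤s (∣p∪q∣≤∣p∣+∣q∣ p q)) (≤-reflexive (≡-sym (+-suc ∣ p ∣ ∣ q ∣)))
∣p∪q∣≤∣p∣+∣q∣ (false ∷ p) (false ∷ q) = ∣p∪q∣≤∣p∣+∣q∣ p q

∣⊆pair∣≤2 : ∀ {n} {B : Subset n} (v b : Fin n) →
            (∀ {w} → w ∈ B → w ≡ v ⊎ w ≡ b) → ∣ B ∣ ≤ 2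
∣⊆pair∣≤2 {B = B} v b members = begin
  ∣ B ∣                   ≤⟨ p⊆q⇒∣p∣≤∣q∣ B⊆vb ⟩
  ∣ ⁅ v ⁆ ∪ ⁅ b ⁆ ∣        ≤⟨ ∣p∪q∣≤∣p∣+∣q∣ ⁅ v ⁆ ⁅ b ⁆ ⟩
  ∣ ⁅ v ⁆ ∣ + ∣ ⁅ b ⁆ ∣    ≡⟨ cong₂ _+_ (∣⁅x⁆∣≡1 v) (∣⁅x⁆∣≡1 b) ⟩
  2                       ∎
  where
  open ≤-Reasoning
  B⊆vb : B ⊆ ⁅ v ⁆ ∪ ⁅ b ⁆
  B⊆vb w∈B with members w∈B
  ... | inj₁ refl = x∈p∪q⁺ (inj₁ (x∈⁅x⁆ v))
  ... | inj₂ refl = x∈p∪q⁺ (inj₂ (x∈⁅x⁆ b))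

∣distinct∣≤∣p∣ : ∀ {n} (p : Subset n) {xs : List (Fin n)} →
                 Unique xs → All (_∈ p) xs → length xs ≤ ∣ p ∣
∣distinct∣≤∣p∣ p {[]ₗ}      _                  _              = z≤n
∣distinct∣≤∣p∣ p {x ∷ₗ xs} (x∉xs ∷ᵖ distinct) (x∈p ∷ᵃ xs⊆p) =
  ≤-trans (s≤s (∣distinct∣≤∣p∣ (p - x) distinct xs⊆p-x)) (x∈p⇒∣p-x∣<∣p∣ x∈p)
  where
  xs⊆p-x : All (_∈ p - x) xs
  xs⊆p-x = All.zipWith (λ (y∈p , x≢y) → x∈p∧x≢y⇒x∈p-y y∈p (λ y≡x → x≢y (≡-sym y≡x)))
                       (xs⊆p , x∉xs)

false≢true : false ≢ true
false≢true ()

adj⇒≢ : ∀ {n} {G : Graph n} {x y} → adj G x y ≡ true → x ≢ y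
adj⇒≢ {G = G} {x} xy refl = false≢true (trans (≡-sym (irrefl G x)) xy)

¬4≤3 : ¬ 4 ≤ 3
¬4≤3 (s≤s (s≤s (s≤s ())))

distinct-neighbours≤3 : ∀ {n} {G : Graph n} → Subcubic G → ∀ v {xs : List (Fin n)} →
                        Unique xs → All (λ x → adj G v x ≡ true) xs → length xs ≤ 3
distinct-neighbours≤3 {G = G} subcubic v distinct adjacent =
  ≤-trans (∣distinct∣≤∣p∣ (N G v) distinct (All.map (∈-tabulate⁺ (adj G v)) adjacent))
          (subcubic v)


does⇒ : ∀ {p} {P : Set p} (d : Dec P) → does d ≡ true → P
does⇒ (yes p) _ = p

at-most-one-or-two : ∀ {n p} {P : Fin n → Set p} → (∀ x → Dec (P x)) →
                     (∀ {x y} → P x → P y → x ≡ y) ⊎ (∃₂ λ x y → P x × P y × x ≢ y)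
at-most-one-or-two {P = P} P?
  with Fin.any? (λ x → P? x ×-dec Fin.any? (λ y → P? y ×-dec ¬? (x ≟ᶠ y)))
... | yes (x , Px , y , Py , x≢y) = inj₂ (x , y , Px , Py , x≢y)
... | no none = inj₁ at-most-one
  where
  at-most-one : ∀ {x y} → P x → P y → x ≡ y
  at-most-one {x} {y} Px Py with x ≟ᶠ y
  ... | yes x≡y = x≡y
  ... | no x≢y  = ⊥-elim (none (x , Px , y , Py , x≢y))

anyFin-sound : ∀ {n} (p : Fin n → Bool) → anyFin p ≡ true → ∃ λ i → p i ≡ true
anyFin-sound {suc n} p any with p Fin.zero in p0
... | true  = Fin.zero , p0
... | false with anyFin-sound (λ i → p (Fin.suc i)) any
...   | i , pi = Fin.suc i , pi

anyFin-complete : ∀ {n} (p : Fin n → Bool) i → p i ≡ true → anyFin p ≡ true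
anyFin-complete p Fin.zero    p0 rewrite p0 = refl
anyFin-complete p (Fin.suc i) pi with p Fin.zero
... | true  = refl
... | false = anyFin-complete (λ j → p (Fin.suc j)) i pi

module OrientationFacts {n} {G : Graph n} (D : Orientation G) where

  arc⇒≢ : ∀ {u w} → arc D u w ≡ true → u ≢ w
  arc⇒≢ {u} {w} = adj⇒≢ {G = G} ∘ arc⇒adj D u w

  arc⇒¬reverse : ∀ {u w} → arc D u w ≡ true → arc D w u ≢ true
  arc⇒¬reverse {u} {w} u→w w→u with exactly1 D u w (arc⇒adj D u w u→w)
  ... | inj₁ (_ , w↛u) = false≢true (trans (≡-sym w↛u) w→u)
  ... | inj₂ (u↛w , _) = false≢true (trans (≡-sym u↛w) u→w)

  in≢out : ∀ {z v w} → arc D z v ≡ true → arc D v w ≡ true → z ≢ w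
  in≢out z→v v→w refl = arc⇒¬reverse z→v v→w

  AtMostOneOut : Fin n → Set
  AtMostOneOut v = ∀ {w w′} → arc D v w ≡ true → arc D v w′ ≡ true → w ≡ w′

  out⇒adj : ∀ {v w} → arc D v w ≡ true → adj G v w ≡ true
  out⇒adj = arc⇒adj D _ _

  in⇒adj : ∀ {z v} → arc D z v ≡ true → adj G v z ≡ true
  in⇒adj {z} {v} z→v = trans (Graph.sym G v z) (arc⇒adj D z v z→v)

  out⊆pair : Subcubic G → ∀ {z v a b} → arc D z v ≡ true →
             arc D v a ≡ true → arc D v b ≡ true → a ≢ b →
             ∀ {x} → arc D v x ≡ true → x ≡ a ⊎ x ≡ b
  out⊆pair subcubic {z} {v} {a} {b} z→v v→a v→b a≢b {x} v→x with x ≟ᶠ a | x ≟ᶠ b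
  ... | yes x≡a | _       = inj₁ x≡a
  ... | no _    | yes x≡b = inj₂ x≡b
  ... | no x≢a  | no x≢b  =
    ⊥-elim (¬4≤3 (distinct-neighbours≤3 {G = G} subcubic v distinct adjacent))
    where
    distinct : Unique (z ∷ₗ a ∷ₗ b ∷ₗ x ∷ₗ []ₗ)
    distinct = (in≢out z→v v→a ∷ᵃ in≢out z→v v→b ∷ᵃ in≢out z→v v→x ∷ᵃ []ᵃ)
            ∷ᵖ (a≢b ∷ᵃ ≢-sym x≢a ∷ᵃ []ᵃ) ∷ᵖ (≢-sym x≢b ∷ᵃ []ᵃ) ∷ᵖ []ᵃ ∷ᵖ []ᵖ
    adjacent : All (λ y → adj G v y ≡ true) (z ∷ₗ a ∷ₗ b ∷ₗ x ∷ₗ []ₗ)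
    adjacent = in⇒adj z→v ∷ᵃ out⇒adj v→a ∷ᵃ out⇒adj v→b ∷ᵃ out⇒adj v→x ∷ᵃ []ᵃ

  two-in⇒AtMostOneOut : Subcubic G → ∀ {p q v} → arc D p v ≡ true → arc D q v ≡ true →
                        p ≢ q → AtMostOneOut v
  two-in⇒AtMostOneOut subcubic {p} {q} {v} p→v q→v p≢q {x} {y} v→x v→y with x ≟ᶠ y
  ... | yes x≡y = x≡y
  ... | no x≢y  = ⊥-elim (¬4≤3 (distinct-neighbours≤3 {G = G} subcubic v distinct adjacent))
    where
    distinct : Unique (p ∷ₗ q ∷ₗ x ∷ₗ y ∷ₗ []ₗ)
    distinct = (p≢q ∷ᵃ in≢out p→v v→x ∷ᵃ in≢out p→v v→y ∷ᵃ []ᵃ)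
            ∷ᵖ (in≢out q→v v→x ∷ᵃ in≢out q→v v→y ∷ᵃ []ᵃ) ∷ᵖ (x≢y ∷ᵃ []ᵃ) ∷ᵖ []ᵃ ∷ᵖ []ᵖ
    adjacent : All (λ w → adj G v w ≡ true) (p ∷ₗ q ∷ₗ x ∷ₗ y ∷ₗ []ₗ)
    adjacent = in⇒adj p→v ∷ᵃ in⇒adj q→v ∷ᵃ out⇒adj v→x ∷ᵃ out⇒adj v→y ∷ᵃ []ᵃ

module Firefighting {n} {G : Graph n} (D : Orientation G) where
  open OrientationFacts D

  outN⁺ : ∀ {B u w} → u ∈ B → arc D u w ≡ true → w ∈ outN D B
  outN⁺ {B} {u} {w} u∈B u→w = ∈-tabulate⁺ _ (anyFin-complete _ u u∈B∧u→w)
    where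
    u∈B∧u→w : lookup B u ∧ arc D u w ≡ true
    u∈B∧u→w rewrite []=⇒lookup u∈B = u→w

  outN⁻ : ∀ {B w} → w ∈ outN D B → ∃ λ u → u ∈ B × arc D u w ≡ true
  outN⁻ {B} {w} w∈ with anyFin-sound _ (∈-tabulate⁻ _ w∈)
  ... | u , u∈B∧u→w =
    u , lookup⇒[]= u B (∧-conicalˡ _ _ u∈B∧u→w) , ∧-conicalʳ _ _ u∈B∧u→w

  outN-⁅⁆ : ∀ {v w} → w ∈ outN D ⁅ v ⁆ → arc D v w ≡ true
  outN-⁅⁆ {v} {w} w∈ with outN⁻ w∈
  ... | u , u∈⁅v⁆ , u→w = subst (λ t → arc D t w ≡ true) (x∈⁅y⁆⇒x≡y v u∈⁅v⁆) u→w

  spread⁻ : ∀ {B Q w} → w ∈ spread D B Q → w ∈ B ⊎ (w ∈ outN D B × w ∉ Q)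
  spread⁻ {B} {Q} w∈ with x∈p∪q⁻ B _ w∈
  ... | inj₁ w∈B  = inj₁ w∈B
  ... | inj₂ w∈N∖Q with x∈p∩q⁻ _ _ w∈N∖Q
  ...   | w∈N , w∈∁Q = inj₂ (w∈N , x∈∁p⇒x∉p w∈∁Q)

  spread-stays : ∀ {B Q w} → w ∈ B → w ∈ spread D B Q
  spread-stays w∈B = x∈p∪q⁺ (inj₁ w∈B)

  spread-new : ∀ {B Q w} → w ∈ outN D B → w ∉ Q → w ∈ spread D B Q
  spread-new w∈N w∉Q = x∈p∪q⁺ (inj₂ (x∈p∩q⁺ (w∈N , x∉p⇒x∈∁p w∉Q)))

  Escape : Subset n → Subset n → Fin n → Set
  Escape B P w = w ∈ outN D B × w ∉ B × w ∉ P

  escape? : ∀ B P w → Dec (Escape B P w)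
  escape? B P w = (w ∈? outN D B) ×-dec (¬? (w ∈? B) ×-dec ¬? (w ∈? P))

  no-escape⇒contained : ∀ {B P} → (∀ {w} → ¬ Escape B P w) → Contained D B P
  no-escape⇒contained {B} {P} none u w u∈B u→w with w ∈? B | w ∈? P
  ... | yes w∈B | _       = inj₁ w∈B
  ... | no _    | yes w∈P = inj₂ w∈P
  ... | no w∉B  | no w∉P  = ⊥-elim (none (outN⁺ u∈B u→w , w∉B , w∉P))

  contain-one-escape : ∀ {B P k} → ∣ B ∣ ≤ k →
                       (∀ {w w′} → Escape B P w → Escape B P w′ → w ≡ w′) →
                       CanContain D 1 k B P
  contain-one-escape {B} {P} size unique with Fin.any? (escape? B P)
  ... | no none = done (no-escape⇒contained (λ esc → none (_ , esc))) size
  ... | yes (a , a-esc@(_ , a∉B , a∉P)) =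
    step ⁅ a ⁆ (≤-reflexive (∣⁅x⁆∣≡1 a)) (⁅⁆-disjoint a∉B) (⁅⁆-disjoint a∉P)
         (done (no-escape⇒contained no-escape) (≤-trans (p⊆q⇒∣p∣≤∣q∣ unchanged) size))
    where
    P′ = P ∪ ⁅ a ⁆
    B′ = spread D B P′

    protected-before : ∀ {w} → w ∈ P → w ∈ P′
    protected-before w∈P = x∈p∪q⁺ (inj₁ w∈P)

    escape⇒protected : ∀ {w} → Escape B P w → w ∈ P′
    escape⇒protected w-esc = x∈p∪q⁺ (inj₂ (subst (_∈ ⁅ a ⁆) (unique a-esc w-esc) (x∈⁅x⁆ a)))

    unchanged : B′ ⊆ B
    unchanged w∈B′ with spread⁻ w∈B′
    ... | inj₁ w∈B = w∈B
    ... | inj₂ (w∈N , w∉P′) with _ ∈? B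
    ...   | yes w∈B = w∈B
    ...   | no w∉B  = ⊥-elim (w∉P′ (escape⇒protected (w∈N , w∉B , w∉P′ ∘ protected-before)))

    no-escape : ∀ {w} → ¬ Escape B′ P′ w
    no-escape (w∈N′ , w∉B′ , w∉P′) with outN⁻ w∈N′
    ... | u , u∈B′ , u→w =
      w∉P′ (escape⇒protected (outN⁺ (unchanged u∈B′) u→w , w∉B′ ∘ spread-stays
                             , w∉P′ ∘ protected-before))

  contain-at-weak : ∀ {v} → AtMostOneOut v → CanContain D 1 2 ⁅ v ⁆ ⊥
  contain-at-weak {v} weak =
    contain-one-escape (≤-trans (≤-reflexive (∣⁅x⁆∣≡1 v)) (s≤s z≤n))
      (λ (w∈N , _) (w′∈N , _) → weak (outN-⁅⁆ w∈N) (outN-⁅⁆ w′∈N))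

  contain-two-step : ∀ {v a b} → a ≢ v → (∀ {w} → arc D v w ≡ true → w ≡ a ⊎ w ≡ b) →
                     AtMostOneOut b → CanContain D 1 2 ⁅ v ⁆ ⊥
  contain-two-step {v} {a} {b} a≢v out⊆ab weak-b =
    step ⁅ a ⁆ (≤-reflexive (∣⁅x⁆∣≡1 a)) (⁅⁆-disjoint (a≢v ∘ x∈⁅y⁆⇒x≡y v)) (⁅⁆-disjoint ∉⊥)
      (contain-one-escape (∣⊆pair∣≤2 v b burnt⊆vb)
        (λ w-esc w′-esc → weak-b (escape-from-b w-esc) (escape-from-b w′-esc)))
    where
    P₁ = ⊥ ∪ ⁅ a ⁆
    B₁ = spread D ⁅ v ⁆ P₁

    unprotected-out : ∀ {w} → arc D v w ≡ true → w ∉ P₁ → w ≡ b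
    unprotected-out v→w w∉P₁ with out⊆ab v→w
    ... | inj₁ refl = ⊥-elim (w∉P₁ (x∈p∪q⁺ (inj₂ (x∈⁅x⁆ a))))
    ... | inj₂ w≡b  = w≡b

    burnt⊆vb : ∀ {w} → w ∈ B₁ → w ≡ v ⊎ w ≡ b
    burnt⊆vb w∈B₁ with spread⁻ w∈B₁
    ... | inj₁ w∈⁅v⁆       = inj₁ (x∈⁅y⁆⇒x≡y v w∈⁅v⁆)
    ... | inj₂ (w∈N , w∉P₁) = inj₂ (unprotected-out (outN-⁅⁆ w∈N) w∉P₁)

    -- Every escape after the first step is an out-neighbour of b: an
    -- unprotected out-neighbour of v is b itself, which is already burning.
    escape-from-b : ∀ {w} → Escape B₁ P₁ w → arc D b w ≡ true
    escape-from-b (w∈N , w∉B₁ , w∉P₁) with outN⁻ w∈N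
    ... | u , u∈B₁ , u→w with burnt⊆vb u∈B₁
    ...   | inj₂ refl = u→w
    ...   | inj₁ refl with unprotected-out u→w w∉P₁
    ...     | refl = ⊥-elim (w∉B₁ (spread-new (outN⁺ (x∈⁅x⁆ v) u→w) w∉P₁))

record GreedyRanking {n} (G : Graph n) : Set where
  field
    rank      : Fin n → ℕ
    injective : ∀ {x y} → rank x ≡ rank y → x ≡ y
    successor : ∀ {x y} → adj G x y ≡ true → rank x < rank y →
                ∃ λ z → rank z ≡ suc (rank x) × adj G x z ≡ true

module RankedOrientation {n} {G : Graph n} (ρ : GreedyRanking G) where
  open GreedyRanking ρ

  Back Jump Points : Fin n → Fin n → Set
  Back x y   = rank x ≡ suc (rank y)
  Jump x y   = rank x < rank y × rank y ≢ suc (rank x)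
  Points x y = Back x y ⊎ Jump x y

  points? : ∀ x y → Dec (Points x y)
  points? x y = (rank x ≟ suc (rank y)) ⊎-dec ((rank x <? rank y) ×-dec ¬? (rank y ≟ suc (rank x)))

  points-antisym : ∀ {x y} → Points x y → ¬ Points y x
  points-antisym (inj₁ x⇠y)        (inj₁ y⇠x)        =
    <-asym (≤-reflexive (≡-sym y⇠x)) (≤-reflexive (≡-sym x⇠y))
  points-antisym (inj₁ x⇠y)        (inj₂ (_ , ¬x⇠y)) = ¬x⇠y x⇠y
  points-antisym (inj₂ (_ , ¬y⇠x)) (inj₁ y⇠x)        = ¬y⇠x y⇠x
  points-antisym (inj₂ (x<y , _))  (inj₂ (y<x , _))  = <-asym x<y y<x

  points-total : ∀ {x y} → rank x < rank y → Points x y ⊎ Points y x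
  points-total {x} {y} x<y with rank y ≟ suc (rank x)
  ... | yes y⇠x = inj₂ (inj₁ y⇠x)
  ... | no ¬y⇠x = inj₁ (inj₂ (x<y , ¬y⇠x))

  one-way : ∀ {x y} → Points x y ⊎ Points y x →
            (Points x y × ¬ Points y x) ⊎ (¬ Points x y × Points y x)
  one-way (inj₁ p) = inj₁ (p , points-antisym p)
  one-way (inj₂ p) = inj₂ (points-antisym p , p)

  points-one-way : ∀ {x y} → x ≢ y → (Points x y × ¬ Points y x) ⊎ (¬ Points x y × Points y x)
  points-one-way {x} {y} x≢y with <-cmp (rank x) (rank y)
  ... | tri< x<y _ _ = one-way (points-total x<y)
  ... | tri≈ _ x≈y _ = ⊥-elim (x≢y (injective x≈y))
  ... | tri> _ _ y<x = one-way (swap (points-total y<x))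

  ranked-arc : Fin n → Fin n → Bool
  ranked-arc x y = adj G x y ∧ does (points? x y)

  points⇒arc : ∀ {x y} → adj G x y ≡ true → Points x y → ranked-arc x y ≡ true
  points⇒arc {x} {y} xy p rewrite xy | dec-true (points? x y) p = refl

  ¬points⇒¬arc : ∀ {x y} → ¬ Points x y → ranked-arc x y ≡ false
  ¬points⇒¬arc {x} {y} ¬p rewrite dec-false (points? x y) ¬p = ∧-zeroʳ (adj G x y)

  orientation : Orientation G
  orientation = record
    { arc      = ranked-arc
    ; arc⇒adj  = λ x y → ∧-conicalˡ _ _
    ; exactly1 = λ x y xy → ⊎-map (×-map (points⇒arc xy) ¬points⇒¬arc)
                                  (×-map ¬points⇒¬arc (points⇒arc (trans (Graph.sym G y x) xy)))
                                  (points-one-way (adj⇒≢ {G = G} xy))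
    }

  open OrientationFacts orientation
  open Firefighting orientation

  arc⇒points : ∀ {x y} → ranked-arc x y ≡ true → Points x y
  arc⇒points {x} {y} x→y = does⇒ (points? x y) (∧-conicalʳ _ _ x→y)

  back-unique : ∀ {v a b} → Back v a → Back v b → a ≡ b
  back-unique v⇠a v⇠b = injective (suc-injective (trans (≡-sym v⇠a) v⇠b))

  some-jump : ∀ {v a b} → ranked-arc v a ≡ true → ranked-arc v b ≡ true → a ≢ b →
              Jump v a ⊎ Jump v b
  some-jump v→a v→b a≢b with arc⇒points v→a | arc⇒points v→b
  ... | inj₂ jump-a | _           = inj₁ jump-a
  ... | inj₁ _      | inj₂ jump-b = inj₂ jump-b
  ... | inj₁ v⇠a    | inj₁ v⇠b    = ⊥-elim (a≢b (back-unique v⇠a v⇠b))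

  jump⇒successor-in : ∀ {v d} → adj G v d ≡ true → Jump v d →
                      ∃ λ z → rank z ≡ suc (rank v) × ranked-arc z v ≡ true
  jump⇒successor-in {v} vd (v<d , _) with successor vd v<d
  ... | z , z-next , vz = z , z-next , points⇒arc (trans (Graph.sym G z v) vz) (inj₁ z-next)

  two-out⇒successor-in : ∀ {v a b} → ranked-arc v a ≡ true → ranked-arc v b ≡ true → a ≢ b →
                         ∃ λ z → rank z ≡ suc (rank v) × ranked-arc z v ≡ true
  two-out⇒successor-in v→a v→b a≢b with some-jump v→a v→b a≢b
  ... | inj₁ jump-a = jump⇒successor-in (out⇒adj v→a) jump-a
  ... | inj₂ jump-b = jump⇒successor-in (out⇒adj v→b) jump-b

  -- In a subcubic graph the target d of a jump v → d has at most one
  -- out-neighbour: two of them would make the successor of d a second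
  -- in-neighbour of d besides v.
  jump-target-weak : Subcubic G → ∀ {v d} → ranked-arc v d ≡ true → Jump v d → AtMostOneOut d
  jump-target-weak subcubic {v} {d} v→d (v<d , _) {x} {y} d→x d→y with x ≟ᶠ y
  ... | yes x≡y = x≡y
  ... | no x≢y with two-out⇒successor-in d→x d→y x≢y
  ...   | z , z-next , z→d = two-in⇒AtMostOneOut subcubic v→d z→d v≢z d→x d→y
    where
    v≢z : v ≢ z
    v≢z v≡z = <-irrefl (cong rank v≡z) (<-trans v<d (≤-reflexive (≡-sym z-next)))

  -- If v has out-neighbours e and d, the latter by a jump, the two-step
  -- defence applies: v has no third out-neighbour and d is weak.
  jump-defence : Subcubic G → ∀ {v e d} → ranked-arc v e ≡ true → ranked-arc v d ≡ true → e ≢ d →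
                 Jump v d → CanContain orientation 1 2 ⁅ v ⁆ ⊥
  jump-defence subcubic v→e v→d e≢d jump-d with jump⇒successor-in (out⇒adj v→d) jump-d
  ... | z , _ , z→v =
    contain-two-step (≢-sym (arc⇒≢ v→e)) (out⊆pair subcubic z→v v→e v→d e≢d)
                     (jump-target-weak subcubic v→d jump-d)

  β≤2 : Subcubic G → βOriented≤ orientation 1 2
  β≤2 subcubic v with at-most-one-or-two (λ w → ranked-arc v w Bool.≟ true)
  ... | inj₁ weak = contain-at-weak weak
  ... | inj₂ (a , b , v→a , v→b , a≢b) with some-jump v→a v→b a≢b
  ...   | inj₁ jump-a = jump-defence subcubic v→b v→a (≢-sym a≢b) jump-a
  ...   | inj₂ jump-b = jump-defence subcubic v→a v→b a≢b jump-b

module GreedyOrder {n} (G : Graph n) where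

  Vertices : Set
  Vertices = List (Fin n)

  record Choice (c : Fin n) (R : Vertices) : Set where
    field
      next      : Fin n
      rest      : Vertices
      perm      : R ↭ next ∷ₗ rest
      preferred : ∀ {y} → y ∈ₗ R → adj G c y ≡ true → adj G c next ≡ true

  choose : ∀ c r R → Choice c (r ∷ₗ R)
  choose c r R with Any.any? (λ y → adj G c y Bool.≟ true) (r ∷ₗ R)
  ... | no none = record
    { next = r ; rest = R ; perm = ↭-refl
    ; preferred = λ y∈R cy → ⊥-elim (none (lose y∈R cy)) }
  ... | yes some with find some
  ...   | y , y∈R , cy with ∈-∃++ y∈R
  ...     | ys , zs , R≡ = record
    { next = y ; rest = ys ++ zs
    ; perm = subst (_↭ y ∷ₗ ys ++ zs) (≡-sym R≡) (shift y ys zs)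
    ; preferred = λ _ _ → cy }

  -- The greedy listing of R after c, with fuel k ≥ length R.
  order : ℕ → Fin n → Vertices → Vertices
  order zero    c R         = []ₗ
  order (suc k) c []ₗ       = []ₗ
  order (suc k) c (r ∷ₗ R) = next ∷ₗ order k next rest
    where open Choice (choose c r R)

  fuel-left : ∀ {R : Vertices} {x rest k} → R ↭ x ∷ₗ rest → length R ≤ suc k → length rest ≤ k
  fuel-left p len = ≤-pred (subst (_≤ _) (↭-length p) len)

  order-perm : ∀ k c R → length R ≤ k → order k c R ↭ R
  order-perm zero    c []ₗ       _   = ↭-refl
  order-perm (suc k) c []ₗ       _   = ↭-refl
  order-perm (suc k) c (r ∷ₗ R) len =
    ↭-trans (↭-prep next (order-perm k next rest (fuel-left perm len))) (↭-sym perm)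
    where open Choice (choose c r R)

  Greedy : Vertices → Set
  Greedy []ₗ              = ⊤
  Greedy (x ∷ₗ []ₗ)       = ⊤
  Greedy (x ∷ₗ y ∷ₗ xs) =
    (∀ {z} → z ∈ₗ y ∷ₗ xs → adj G x z ≡ true → adj G x y ≡ true) × Greedy (y ∷ₗ xs)

  Greedy-tail : ∀ x xs → Greedy (x ∷ₗ xs) → Greedy xs
  Greedy-tail x []ₗ        _          = tt
  Greedy-tail x (y ∷ₗ xs) (_ , rest) = rest

  order-greedy : ∀ k c R → length R ≤ k → Greedy (c ∷ₗ order k c R)
  order-greedy zero    c []ₗ       _   = tt
  order-greedy (suc k) c []ₗ       _   = tt
  order-greedy (suc k) c (r ∷ₗ R) len =
    (λ z∈ cz → preferred (∈-resp-↭ (order-perm (suc k) c (r ∷ₗ R) len) z∈) cz)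
    , order-greedy k next rest (fuel-left perm len)
    where open Choice (choose c r R)

  position : Vertices → Fin n → ℕ
  position []ₗ       v = 0
  position (x ∷ₗ xs) v with x ≟ᶠ v
  ... | yes _ = 0
  ... | no  _ = suc (position xs v)

  position-here : ∀ {x xs v} → x ≡ v → position (x ∷ₗ xs) v ≡ 0
  position-here {x} {xs} {v} x≡v with x ≟ᶠ v
  ... | yes _   = refl
  ... | no x≢v = ⊥-elim (x≢v x≡v)

  position-there : ∀ {x xs v} → x ≢ v → position (x ∷ₗ xs) v ≡ suc (position xs v)
  position-there {x} {xs} {v} x≢v with x ≟ᶠ v
  ... | yes x≡v = ⊥-elim (x≢v x≡v)
  ... | no _    = refl

  ∈-tail : ∀ {x v} {xs : Vertices} → x ≢ v → v ∈ₗ x ∷ₗ xs → v ∈ₗ xs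
  ∈-tail x≢v (Any.here v≡x) = ⊥-elim (x≢v (≡-sym v≡x))
  ∈-tail x≢v (Any.there v∈) = v∈

  position-injective : ∀ xs {v w} → v ∈ₗ xs → w ∈ₗ xs → position xs v ≡ position xs w → v ≡ w
  position-injective (x ∷ₗ xs) {v} {w} v∈ w∈ same with x ≟ᶠ v | x ≟ᶠ w
  ... | yes x≡v | yes x≡w = trans (≡-sym x≡v) x≡w
  ... | yes _   | no _    with () ← same
  ... | no _    | yes _   with () ← same
  ... | no x≢v  | no x≢w  =
    position-injective xs (∈-tail x≢v v∈) (∈-tail x≢w w∈) (suc-injective same)

  greedy-step : ∀ c cs → All (c ≢_) cs → Greedy (c ∷ₗ cs) → ∀ {y} → y ∈ₗ cs → adj G c y ≡ true →
                ∃ λ z → z ∈ₗ c ∷ₗ cs × position (c ∷ₗ cs) z ≡ 1 × adj G c z ≡ true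
  greedy-step c (d ∷ₗ ds) (c≢d ∷ᵃ _) (followed , _) y∈ cy =
    d , Any.there (Any.here refl) , trans (position-there c≢d) (cong suc (position-here refl))
      , followed y∈ cy

  position-successor : ∀ xs → Unique xs → Greedy xs → ∀ {x y} → x ∈ₗ xs → y ∈ₗ xs →
                       adj G x y ≡ true → position xs x < position xs y →
                       ∃ λ z → z ∈ₗ xs × position xs z ≡ suc (position xs x) × adj G x z ≡ true
  position-successor (c ∷ₗ cs) (c∉cs ∷ᵖ distinct) greedy {x} {y} x∈ y∈ xy x<y
    with c ≟ᶠ x | c ≟ᶠ y
  ... | _        | yes _  = ⊥-elim (n≮0 x<y)
  ... | yes refl | no c≢y = greedy-step c cs c∉cs greedy (∈-tail c≢y y∈) xy
  ... | no c≢x   | no c≢y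
    with position-successor cs distinct (Greedy-tail c cs greedy)
           (∈-tail c≢x x∈) (∈-tail c≢y y∈) xy (≤-pred x<y)
  ...   | z , z∈cs , z-next , xz =
    z , Any.there z∈cs , trans (position-there (All.lookup c∉cs z∈cs)) (cong suc z-next) , xz

greedy-ranking : ∀ {n} (G : Graph n) → GreedyRanking G
greedy-ranking {zero}  G = record { rank = λ () ; injective = λ { {()} } ; successor = λ { {()} } }
greedy-ranking {suc m} G = record
  { rank      = position listing
  ; injective = position-injective listing (listed _) (listed _)
  ; successor = λ xy x<y →
      case position-successor listing distinct greedy (listed _) (listed _) xy x<y of λ
        (z , _ , z-next , xz) → z , z-next , xz
  }
  where
  open GreedyOrder G

  fuel : length (allFin (suc m)) ≤ suc m
  fuel = ≤-reflexive (length-tabulate id)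

  listing : Vertices
  listing = order (suc m) Fin.zero (allFin (suc m))

  listing↭allFin : listing ↭ allFin (suc m)
  listing↭allFin = order-perm (suc m) Fin.zero (allFin (suc m)) fuel

  listed : ∀ v → v ∈ₗ listing
  listed v = ∈-resp-↭ (↭-sym listing↭allFin) (∈-allFin v)

  distinct : Unique listing
  distinct = PermutationSetoid.Unique-resp-↭ (setoid (Fin (suc m)))
               (↭⇒↭ₛ (↭-sym listing↭allFin)) (allFin⁺ (suc m))

  greedy : Greedy listing
  greedy = Greedy-tail Fin.zero listing (order-greedy (suc m) Fin.zero (allFin (suc m)) fuel)

theorem5p5 : ∀ (n : ℕ) (G : Graph n) → Subcubic G → β⃗≤ G 1 2
theorem5p5 n G subcubic = orientation , β≤2 subcubic
  where open RankedOrientation (greedy-ranking G)
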